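{- Let $\mathcal{A}$ and $\mathcal{B}$ be path categories and $\widehat H\colon\mathcal{A}\to\mathcal{B}$ a functor that preserves embeddings (S1). Then $\widehat H$ satisfies (S2) if and only if $\widehat H$ is a parametric relative right adjoint. (S2): every path embedding $e\colon P\rightarrowtail\widehat H(A)$ has a minimal decomposition $e=\widehat H(e_1)\circ e_0$ with $e_0\colon P\to\widehat H(P_1)$ and $e_1\colon P_1\rightarrowtail A$ a path embedding; minimality means that for every decomposition $e=\widehat H(g_1)\circ g_0$ with $g_0\colon P\to\widehat H(Q)$ and $g_1\colon Q\rightarrowtail A$ a path embedding, there is a (necessarily unique) morphism $h\colon P_1\to Q$ with $e_1=g_1\circ h$.
   Context: A path category is a category with a proper factorisation system $(\mathcal{E},\mathcal{M})$ (every morphism factors as $m\circ e$; the two classes are each other's weak-orthogonality classes; $\mathcal{E}$ epis, $\mathcal{M}$ monos; members of $\mathcal{M}$ are embeddings) and a chosen class of objects called paths; a path embedding is an embedding whose domain is a path. For an object $C$ of $\mathcal{A}$, let $\mathrm{Paths}_{\mathcal{A}}\Downarrow C$ be the full subcategory of the slice category $\mathcal{A}/C$ on path embeddings $X\rightarrowtail C$; let $\mathcal{B}\Downarrow\widehat H(C)$ be the full subcategory of $\mathcal{B}/\widehat H(C)$ on embeddings into $\widehat H(C)$, and $\mathrm{Paths}_{\mathcal{B}}\Downarrow\widehat H(C)$ its full subcategory on path embeddings, with inclusion $I\colon\mathrm{Paths}_{\mathcal{B}}\Downarrow\widehat H(C)\to\mathcal{B}\Downarrow\widehat H(C)$. Given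 (S1), $\widehat H_C\colon\mathrm{Paths}_{\mathcal{A}}\Downarrow C\to\mathcal{B}\Downarrow\widehat H(C)$ sends $e\colon X\rightarrowtail C$ to $\widehat H(e)\colon\widehat H(X)\rightarrowtail\widehat H(C)$. A functor $R\colon\mathcal{T}\to\mathcal{U}$ is a relative right adjoint with respect to $I\colon\mathcal{S}\to\mathcal{U}$ if there is a functor $L\colon\mathcal{S}\to\mathcal{T}$ and a bijection $\mathcal{T}(L(S),T)\cong\mathcal{U}(I(S),R(T))$ natural in $S$ and $T$. $\widehat H$ is a parametric relative right adjoint if for every object $C$ of $\mathcal{A}$, $\widehat H_C$ is a relative right adjoint with respect to $I\colon\mathrm{Paths}_{\mathcal{B}}\Downarrow\widehat H(C)\to\mathcal{B}\Downarrow\widehat H(C)$. -}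

module Defs where

open import Level using (Level; _⊔_) renaming (suc to lsuc)
open import Relation.Binary using (Rel; IsEquivalence)
open import Data.Product using (Σ; _×_; _,_; proj₁; proj₂)

record Category (o ℓ e : Level) : Set (lsuc (o ⊔ ℓ ⊔ e)) where
  infixr 9 _∘_
  infix 4 _≈_ _⇒_
  field
    Obj : Set o
    _⇒_ : Obj → Obj → Set ℓ
    _≈_ : ∀ {A B} → Rel (A ⇒ B) e
    id  : ∀ {A} → A ⇒ A
    _∘_ : ∀ {A B C} → B ⇒ C → A ⇒ B → A ⇒ C
    ≈-equiv  : ∀ {A B} → IsEquivalence (_≈_ {A} {B})
    ∘-resp-≈ : ∀ {A B C} {f h : B ⇒ C} {g i : A ⇒ B} →
               f ≈ h → g ≈ i → f ∘ g ≈ h ∘ i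
    identityˡ : ∀ {A B} {f : A ⇒ B} → id ∘ f ≈ f
    identityʳ : ∀ {A B} {f : A ⇒ B} → f ∘ id ≈ f
    assoc     : ∀ {A B C D} {f : A ⇒ B} {g : B ⇒ C} {h : C ⇒ D} →
                (h ∘ g) ∘ f ≈ h ∘ (g ∘ f)

  ≈-refl : ∀ {A B} {f : A ⇒ B} → f ≈ f
  ≈-refl = IsEquivalence.refl ≈-equiv
  ≈-sym : ∀ {A B} {f g : A ⇒ B} → f ≈ g → g ≈ f
  ≈-sym = IsEquivalence.sym ≈-equiv
  ≈-trans : ∀ {A B} {f g h : A ⇒ B} → f ≈ g → g ≈ h → f ≈ h
  ≈-trans = IsEquivalence.trans ≈-equiv

  Mono : ∀ {A B} → A ⇒ B → Set (o ⊔ ℓ ⊔ e)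
  Mono {A} f = ∀ {X} (g h : X ⇒ A) → f ∘ g ≈ f ∘ h → g ≈ h

  Epi : ∀ {A B} → A ⇒ B → Set (o ⊔ ℓ ⊔ e)
  Epi {B = B} f = ∀ {X} (g h : B ⇒ X) → g ∘ f ≈ h ∘ f → g ≈ h

  _⋔_ : ∀ {A B X Y} → A ⇒ B → X ⇒ Y → Set (ℓ ⊔ e)
  _⋔_ {A} {B} {X} {Y} f m =
    (u : A ⇒ X) (v : B ⇒ Y) → m ∘ u ≈ v ∘ f →
    Σ (B ⇒ X) λ d → (d ∘ f ≈ u) × (m ∘ d ≈ v)

module C = Category

MorClass : ∀ {o ℓ e} → Category o ℓ e → (p : Level) → Set (o ⊔ ℓ ⊔ lsuc p)
MorClass 𝒞 p = ∀ {A B} → C._⇒_ 𝒞 A B → Set p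

record IsProperFactorisationSystem {o ℓ e p} (𝒞 : Category o ℓ e)
       (E M : MorClass 𝒞 p) : Set (o ⊔ ℓ ⊔ e ⊔ p) where
  open Category 𝒞 using (_⇒_; _∘_; _≈_; _⋔_; Mono; Epi; Obj)
  field
    factor : ∀ {A B} (f : A ⇒ B) →
             Σ Obj λ Z → Σ (A ⇒ Z) λ ε → Σ (Z ⇒ B) λ μ →
               E ε × M μ × (μ ∘ ε ≈ f)
    E-⋔M : ∀ {A B} (f : A ⇒ B) →
           (E f → ∀ {X Y} (m : X ⇒ Y) → M m → f ⋔ m) ×
           ((∀ {X Y} (m : X ⇒ Y) → M m → f ⋔ m) → E f)
    M-E⋔ : ∀ {X Y} (m : X ⇒ Y) →
           (M m → ∀ {A B} (f : A ⇒ B) → E f → f ⋔ m) ×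
           ((∀ {A B} (f : A ⇒ B) → E f → f ⋔ m) → M m)
    E-epi  : ∀ {A B} {f : A ⇒ B} → E f → Epi f
    M-mono : ∀ {A B} {m : A ⇒ B} → M m → Mono m

record PathCategory (o ℓ e p : Level) : Set (lsuc (o ⊔ ℓ ⊔ e ⊔ p)) where
  field
    cat : Category o ℓ e
    𝓔 𝓜 : MorClass cat p
    factorisation : IsProperFactorisationSystem cat 𝓔 𝓜
    IsPath : C.Obj cat → Set p

  Embedding : MorClass cat p
  Embedding = 𝓜

  PathEmbedding : MorClass cat p
  PathEmbedding {A} f = IsPath A × Embedding f

open PathCategory

record Functor {o₁ ℓ₁ e₁ o₂ ℓ₂ e₂} (𝒞 : Category o₁ ℓ₁ e₁) (𝒟 : Category o₂ ℓ₂ e₂)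
       : Set (o₁ ⊔ ℓ₁ ⊔ e₁ ⊔ o₂ ⊔ ℓ₂ ⊔ e₂) where
  field
    F₀ : C.Obj 𝒞 → C.Obj 𝒟
    F₁ : ∀ {A B} → C._⇒_ 𝒞 A B → C._⇒_ 𝒟 (F₀ A) (F₀ B)
    identity     : ∀ {A} → C._≈_ 𝒟 (F₁ (C.id 𝒞 {A})) (C.id 𝒟)
    homomorphism : ∀ {A B C} {f : C._⇒_ 𝒞 A B} {g : C._⇒_ 𝒞 B C} →
                   C._≈_ 𝒟 (F₁ (C._∘_ 𝒞 g f)) (C._∘_ 𝒟 (F₁ g) (F₁ f))
    F-resp-≈     : ∀ {A B} {f g : C._⇒_ 𝒞 A B} → C._≈_ 𝒞 f g → C._≈_ 𝒟 (F₁ f) (F₁ g)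

module F = Functor

record RelativeRightAdjoint {o₁ ℓ₁ e₁ o₂ ℓ₂ e₂ o₃ ℓ₃ e₃}
       {𝒮 : Category o₁ ℓ₁ e₁} {𝒯 : Category o₂ ℓ₂ e₂} {𝒰 : Category o₃ ℓ₃ e₃}
       (I : Functor 𝒮 𝒰) (R : Functor 𝒯 𝒰)
       : Set (o₁ ⊔ ℓ₁ ⊔ e₁ ⊔ o₂ ⊔ ℓ₂ ⊔ e₂ ⊔ o₃ ⊔ ℓ₃ ⊔ e₃) where
  field
    L : Functor 𝒮 𝒯
    φ : ∀ {S T} → C._⇒_ 𝒯 (F.F₀ L S) T → C._⇒_ 𝒰 (F.F₀ I S) (F.F₀ R T)
    ψ : ∀ {S T} → C._⇒_ 𝒰 (F.F₀ I S) (F.F₀ R T) → C._⇒_ 𝒯 (F.F₀ L S) T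
    φ-resp-≈ : ∀ {S T} {f g : C._⇒_ 𝒯 (F.F₀ L S) T} →
               C._≈_ 𝒯 f g → C._≈_ 𝒰 (φ f) (φ g)
    ψ-resp-≈ : ∀ {S T} {f g : C._⇒_ 𝒰 (F.F₀ I S) (F.F₀ R T)} →
               C._≈_ 𝒰 f g → C._≈_ 𝒯 (ψ f) (ψ g)
    ψφ : ∀ {S T} (f : C._⇒_ 𝒯 (F.F₀ L S) T) → C._≈_ 𝒯 (ψ (φ f)) f
    φψ : ∀ {S T} (g : C._⇒_ 𝒰 (F.F₀ I S) (F.F₀ R T)) → C._≈_ 𝒰 (φ (ψ g)) g
    natural : ∀ {S S′ T T′} (a : C._⇒_ 𝒮 S′ S) (b : C._⇒_ 𝒯 T T′)
              (f : C._⇒_ 𝒯 (F.F₀ L S) T) →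
              C._≈_ 𝒰 (φ (C._∘_ 𝒯 b (C._∘_ 𝒯 f (F.F₁ L a))))
                    (C._∘_ 𝒰 (F.F₁ R b) (C._∘_ 𝒰 (φ f) (F.F₁ I a)))

module _ {o ℓ e q} (𝒞 : Category o ℓ e) (c : C.Obj 𝒞)
         (P : ∀ {X} → C._⇒_ 𝒞 X c → Set q) where
  open Category 𝒞

  record SliceObj : Set (o ⊔ ℓ ⊔ q) where
    constructor sliceObj
    field
      dom : Obj
      arr : dom ⇒ c
      prop : P arr

  record SliceHom (x y : SliceObj) : Set (ℓ ⊔ e) where
    constructor sliceHom
    field
      h : SliceObj.dom x ⇒ SliceObj.dom y
      commutes : SliceObj.arr y ∘ h ≈ SliceObj.arr x

  SliceSub : Category (o ⊔ ℓ ⊔ q) (ℓ ⊔ e) e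
  SliceSub = record
    { Obj = SliceObj
    ; _⇒_ = SliceHom
    ; _≈_ = λ f g → SliceHom.h f ≈ SliceHom.h g
    ; id = λ {x} → sliceHom id identityʳ
    ; _∘_ = λ {x} {y} {z} g f →
        sliceHom (SliceHom.h g ∘ SliceHom.h f)
          (≈-trans (≈-sym assoc)
            (≈-trans (∘-resp-≈ (SliceHom.commutes g) ≈-refl) (SliceHom.commutes f)))
    ; ≈-equiv = record { refl = ≈-refl ; sym = ≈-sym ; trans = ≈-trans }
    ; ∘-resp-≈ = ∘-resp-≈
    ; identityˡ = identityˡ
    ; identityʳ = identityʳ
    ; assoc = assoc
    }

module _ {o₁ ℓ₁ e₁ p₁ o₂ ℓ₂ e₂ p₂}
         (𝒜 : PathCategory o₁ ℓ₁ e₁ p₁) (ℬ : PathCategory o₂ ℓ₂ e₂ p₂)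
         (H : Functor (PathCategory.cat 𝒜) (PathCategory.cat ℬ)) where
  private
    module A = Category (PathCategory.cat 𝒜)
    module B = Category (PathCategory.cat ℬ)
    H₀ = Functor.F₀ H
    H₁ : ∀ {X Y} → X A.⇒ Y → H₀ X B.⇒ H₀ Y
    H₁ = Functor.F₁ H

  S1 : Set (o₁ ⊔ ℓ₁ ⊔ p₁ ⊔ p₂)
  S1 = ∀ {X Y} {f : X A.⇒ Y} → Embedding 𝒜 f → Embedding ℬ (H₁ f)

  S2 : Set (o₁ ⊔ ℓ₁ ⊔ e₁ ⊔ p₁ ⊔ o₂ ⊔ ℓ₂ ⊔ e₂ ⊔ p₂)
  S2 = ∀ {P : B.Obj} {A : A.Obj} (e : P B.⇒ H₀ A) → PathEmbedding ℬ e →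
       Σ A.Obj λ P₁ → Σ (P₁ A.⇒ A) λ e₁ → Σ (P B.⇒ H₀ P₁) λ e₀ →
         PathEmbedding 𝒜 e₁ × (e B.≈ H₁ e₁ B.∘ e₀) ×
         (∀ {Q : A.Obj} (g₁ : Q A.⇒ A) (g₀ : P B.⇒ H₀ Q) →
            PathEmbedding 𝒜 g₁ → e B.≈ H₁ g₁ B.∘ g₀ →
            Σ (P₁ A.⇒ Q) λ h → e₁ A.≈ g₁ A.∘ h)

  Paths𝒜⇓ : A.Obj → Category (o₁ ⊔ ℓ₁ ⊔ p₁) (ℓ₁ ⊔ e₁) e₁
  Paths𝒜⇓ C = SliceSub (PathCategory.cat 𝒜) C (λ f → PathEmbedding 𝒜 f)

  ℬ⇓ : B.Obj → Category (o₂ ⊔ ℓ₂ ⊔ p₂) (ℓ₂ ⊔ e₂) e₂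
  ℬ⇓ D = SliceSub (PathCategory.cat ℬ) D (λ f → Embedding ℬ f)

  Pathsℬ⇓ : B.Obj → Category (o₂ ⊔ ℓ₂ ⊔ p₂) (ℓ₂ ⊔ e₂) e₂
  Pathsℬ⇓ D = SliceSub (PathCategory.cat ℬ) D (λ f → PathEmbedding ℬ f)

  Incl : (D : B.Obj) → Functor (Pathsℬ⇓ D) (ℬ⇓ D)
  Incl D = record
    { F₀ = λ x → sliceObj (SliceObj.dom x) (SliceObj.arr x) (proj₂ (SliceObj.prop x))
    ; F₁ = λ f → sliceHom (SliceHom.h f) (SliceHom.commutes f)
    ; identity = B.≈-refl
    ; homomorphism = B.≈-refl
    ; F-resp-≈ = λ p → p
    }

  Ĥ_ : S1 → (C : A.Obj) → Functor (Paths𝒜⇓ C) (ℬ⇓ (H₀ C))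
  Ĥ_ s1 C = record
    { F₀ = λ x → sliceObj (H₀ (SliceObj.dom x)) (H₁ (SliceObj.arr x))
                          (s1 (proj₂ (SliceObj.prop x)))
    ; F₁ = λ f → sliceHom (H₁ (SliceHom.h f))
                   (B.≈-trans (B.≈-sym (Functor.homomorphism H))
                              (Functor.F-resp-≈ H (SliceHom.commutes f)))
    ; identity = Functor.identity H
    ; homomorphism = Functor.homomorphism H
    ; F-resp-≈ = Functor.F-resp-≈ H
    }

  IsParametricRelativeRightAdjoint : S1 → Set _
  IsParametricRelativeRightAdjoint s1 =
    (C : A.Obj) → RelativeRightAdjoint (Incl (H₀ C)) (Ĥ_ s1 C)

{-# OPTIONS --safe #-}
module Submission where

open import Level using (Level; _⊔_)
open import Data.Product using (Σ; _×_; _,_; proj₂)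
open import Defs

-- Both slice categories involved are thin, because their objects are embeddings and
-- embeddings are monos.  A relative right adjoint between such categories is therefore
-- nothing but a choice, for each path embedding S into Ĥ(C), of an object L S with a
-- morphism S → Ĥ_C (L S) through which every S → Ĥ_C T factors as Ĥ_C (L S → T).
-- Spelled out in the slices, this is literally a minimal decomposition as in (S2).

private
  variable
    o ℓ e q o₁ ℓ₁ e₁ o₂ ℓ₂ e₂ o₃ ℓ₃ e₃ p₁ p₂ : Level

SliceHom-unique : {𝒞 : Category o ℓ e} {c : C.Obj 𝒞}
                  {P : ∀ {X} → C._⇒_ 𝒞 X c → Set q} {x y : SliceObj 𝒞 c P} →
                  C.Mono 𝒞 (SliceObj.arr y) → (f g : SliceHom 𝒞 c P x y) →
                  C._≈_ 𝒞 (SliceHom.h f) (SliceHom.h g)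
SliceHom-unique {𝒞 = 𝒞} mono f g =
  mono _ _ (≈-trans (SliceHom.commutes f) (≈-sym (SliceHom.commutes g)))
  where open Category 𝒞

record WeakUniversalArrow {𝒮 : Category o₁ ℓ₁ e₁} {𝒯 : Category o₂ ℓ₂ e₂}
       {𝒰 : Category o₃ ℓ₃ e₃} (I : Functor 𝒮 𝒰) (R : Functor 𝒯 𝒰) (S : C.Obj 𝒮)
       : Set (o₂ ⊔ ℓ₂ ⊔ ℓ₃) where
  field
    obj  : C.Obj 𝒯
    unit : C._⇒_ 𝒰 (F.F₀ I S) (F.F₀ R obj)
    lift : ∀ {T} → C._⇒_ 𝒰 (F.F₀ I S) (F.F₀ R T) → C._⇒_ 𝒯 obj T

module _ {𝒮 : Category o₁ ℓ₁ e₁} {𝒯 : Category o₂ ℓ₂ e₂} {𝒰 : Category o₃ ℓ₃ e₃}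
         {I : Functor 𝒮 𝒰} {R : Functor 𝒯 𝒰} where
  private
    module 𝒯 = Category 𝒯
    module 𝒰 = Category 𝒰
    module I = Functor I
    module R = Functor R

  relativeRightAdjoint⇒weakUniversalArrow :
    RelativeRightAdjoint I R → ∀ S → WeakUniversalArrow I R S
  relativeRightAdjoint⇒weakUniversalArrow adj S = record
    { obj = F.F₀ L S ; unit = φ 𝒯.id ; lift = ψ }
    where open RelativeRightAdjoint adj

  weakUniversalArrows⇒relativeRightAdjoint :
    (∀ {X Y} (f g : X 𝒯.⇒ Y) → f 𝒯.≈ g) →
    (∀ {U} T (f g : U 𝒰.⇒ R.F₀ T) → f 𝒰.≈ g) →
    (∀ S → WeakUniversalArrow I R S) → RelativeRightAdjoint I R
  weakUniversalArrows⇒relativeRightAdjoint 𝒯-thin R-thin arrow = record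
    { L = record
      { F₀ = obj
      ; F₁ = λ {S} {S′} a → lift S (unit S′ 𝒰.∘ I.F₁ a)
      ; identity = 𝒯-thin _ _
      ; homomorphism = 𝒯-thin _ _
      ; F-resp-≈ = λ _ → 𝒯-thin _ _
      }
    ; φ = λ {S} f → R.F₁ f 𝒰.∘ unit S
    ; ψ = lift _
    ; φ-resp-≈ = λ _ → R-thin _ _ _
    ; ψ-resp-≈ = λ _ → 𝒯-thin _ _
    ; ψφ = λ _ → 𝒯-thin _ _
    ; φψ = λ _ → R-thin _ _ _
    ; natural = λ _ _ _ → R-thin _ _ _
    }
    where
    open module Arrow S = WeakUniversalArrow (arrow S)

module _ (𝒜 : PathCategory o₁ ℓ₁ e₁ p₁) (ℬ : PathCategory o₂ ℓ₂ e₂ p₂)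
         (H : Functor (PathCategory.cat 𝒜) (PathCategory.cat ℬ)) where
  private
    module A = Category (PathCategory.cat 𝒜)
    module B = Category (PathCategory.cat ℬ)
    module FA = IsProperFactorisationSystem (PathCategory.factorisation 𝒜)
    module FB = IsProperFactorisationSystem (PathCategory.factorisation ℬ)
    open Functor H

  Paths𝒜⇓-thin : ∀ C {X Y} (f g : C._⇒_ (Paths𝒜⇓ 𝒜 ℬ H C) X Y) →
                 C._≈_ (Paths𝒜⇓ 𝒜 ℬ H C) f g
  Paths𝒜⇓-thin C {Y = Y} = SliceHom-unique (FA.M-mono (proj₂ (SliceObj.prop Y)))

  module _ (s1 : S1 𝒜 ℬ H) where

    Ĥ-thin : ∀ C {U} T (f g : C._⇒_ (ℬ⇓ 𝒜 ℬ H (F₀ C)) U (F.F₀ (Ĥ_ 𝒜 ℬ H s1 C) T)) →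
             C._≈_ (ℬ⇓ 𝒜 ℬ H (F₀ C)) f g
    Ĥ-thin C T = SliceHom-unique (FB.M-mono (s1 (proj₂ (SliceObj.prop T))))

    WeakUniversalArrows : Set (o₁ ⊔ ℓ₁ ⊔ e₁ ⊔ p₁ ⊔ o₂ ⊔ ℓ₂ ⊔ e₂ ⊔ p₂)
    WeakUniversalArrows =
      ∀ C S → WeakUniversalArrow (Incl 𝒜 ℬ H (F₀ C)) (Ĥ_ 𝒜 ℬ H s1 C) S

    S2⇒weakUniversalArrows : S2 𝒜 ℬ H → WeakUniversalArrows
    S2⇒weakUniversalArrows s2 C (sliceObj P e pe) with s2 e pe
    ... | P₁ , e₁ , e₀ , pe₁ , e≈ , minimal = record
      { obj = sliceObj P₁ e₁ pe₁
      ; unit = sliceHom e₀ (B.≈-sym e≈)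
      ; lift = λ { {sliceObj Q g₁ pg} (sliceHom g₀ g≈) →
                   let h , e₁≈ = minimal g₁ g₀ pg (B.≈-sym g≈)
                   in sliceHom h (A.≈-sym e₁≈) }
      }

    weakUniversalArrows⇒S2 : WeakUniversalArrows → S2 𝒜 ℬ H
    weakUniversalArrows⇒S2 arrow {P} {A} e pe =
      dom , arr , SliceHom.h unit , prop , B.≈-sym (SliceHom.commutes unit) , minimal
      where
      open WeakUniversalArrow (arrow A (sliceObj P e pe))
      open SliceObj obj
      minimal : ∀ {Q} (g₁ : Q A.⇒ A) (g₀ : P B.⇒ F₀ Q) → PathCategory.PathEmbedding 𝒜 g₁ →
                e B.≈ F₁ g₁ B.∘ g₀ → Σ (dom A.⇒ Q) λ h → arr A.≈ g₁ A.∘ h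
      minimal g₁ g₀ pg e≈ with lift {sliceObj _ g₁ pg} (sliceHom g₀ (B.≈-sym e≈))
      ... | sliceHom h h≈ = h , A.≈-sym h≈

propositionA2 : ∀ {o₁ ℓ₁ e₁ p₁ o₂ ℓ₂ e₂ p₂}
    (𝒜 : PathCategory o₁ ℓ₁ e₁ p₁) (ℬ : PathCategory o₂ ℓ₂ e₂ p₂)
    (H : Functor (PathCategory.cat 𝒜) (PathCategory.cat ℬ))
    (s1 : S1 𝒜 ℬ H) →
    (S2 𝒜 ℬ H → IsParametricRelativeRightAdjoint 𝒜 ℬ H s1) ×
    (IsParametricRelativeRightAdjoint 𝒜 ℬ H s1 → S2 𝒜 ℬ H)
propositionA2 𝒜 ℬ H s1 =
  (λ s2 C → weakUniversalArrows⇒relativeRightAdjoint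
              (Paths𝒜⇓-thin 𝒜 ℬ H C) (Ĥ-thin 𝒜 ℬ H s1 C)
              (S2⇒weakUniversalArrows 𝒜 ℬ H s1 s2 C)) ,
  (λ adj → weakUniversalArrows⇒S2 𝒜 ℬ H s1 λ C →
             relativeRightAdjoint⇒weakUniversalArrow (adj C))
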